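{- (Squishing Lemma.) Let $G$ be a simple graph and $v\in V(G)$. If $v$ is not reachable from some pebble distribution on $G$ of size $n$, then there is a pebble distribution $r$ on $G$ of size $n$ that is squished on each thread of $G$ not containing $v$, such that $v$ is not reachable from $r$ either.
   Context: A thread in $G$ is a path in $G$ all of whose vertices have degree 2 in $G$. A pebble distribution is squished on a thread $P$ if all pebbles on $P$ lie on a single vertex of $P$ or on two adjacent vertices of $P$. A pebble distribution on $G$ is a function $p:V(G)\to\mathbb{Z}_{\ge0}$, its size is $\sum_u p(u)$. If $\{a,u\}\in E(G)$, the pebbling move $(a,a\to u)$ removes two pebbles at $a$ and adds one at $u$. If $a\ne b$ and $\{a,u\},\{b,u\}\in E(G)$, the strict rubbling move $(a,b\to u)$ removes one pebble at each of $a$ and $b$ and adds one at $u$. A rubbling move is either of these. A vertex $x$ is reachable from $p$ if there is a sequence of rubbling moves, with pebble counts never becoming negative, after which $x$ has at least one pebble. -}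

module Defs where

open import Data.Nat using (ℕ; zero; suc; _+_; _*_; _≥_)
open import Data.Bool using (Bool; true; false; if_then_else_)
open import Data.Fin using (Fin; _≟_)
import Data.Bool as Bool
open import Data.List using (List; []; _∷_; allFin; map; filter; length)
open import Data.Nat.ListAction using (sum)
open import Data.List.Membership.Propositional using (_∈_)
open import Data.List.Relation.Unary.Unique.Propositional using (Unique)
open import Data.Product using (Σ; ∃; _×_; _,_)
open import Data.Sum using (_⊎_)
open import Relation.Nullary using (¬_)
open import Relation.Nullary.Decidable using (⌊_⌋)
open import Relation.Binary.PropositionalEquality using (_≡_; _≢_)
open import Relation.Binary.Construct.Closure.ReflexiveTransitive using (Star)

record Graph : Set where
  field
    order : ℕ
    adj   : Fin order → Fin order → Bool
    adj-sym    : ∀ x y → adj x y ≡ adj y x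
    adj-irrefl : ∀ x → adj x x ≡ false

module _ (G : Graph) where
  open Graph G

  V : Set
  V = Fin order

  Adj : V → V → Set
  Adj x y = adj x y ≡ true

  degree : V → ℕ
  degree u = length (filter (λ w → adj u w Bool.≟ true) (allFin order))

  data IsWalk : List V → Set where
    single : ∀ x → IsWalk (x ∷ [])
    cons   : ∀ x y rest → Adj x y → IsWalk (y ∷ rest) → IsWalk (x ∷ y ∷ rest)

  IsPath : List V → Set
  IsPath P = IsWalk P × Unique P

  Thread : List V → Set
  Thread P = IsPath P × (∀ x → x ∈ P → degree x ≡ 2)

  Distribution : Set
  Distribution = V → ℕ

  size : Distribution → ℕ
  size p = sum (map p (allFin order))

  ind : V → V → ℕ
  ind a x = if ⌊ x ≟ a ⌋ then 1 else 0

  -- one rubbling move transforms p into q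
  -- (nonnegativity is automatic since pebble counts are natural numbers)
  data Move (p q : Distribution) : Set where
    pebbling : ∀ a u → Adj a u →
               (∀ x → q x + 2 * ind a x ≡ p x + ind u x) → Move p q
    strict   : ∀ a b u → a ≢ b → Adj a u → Adj b u →
               (∀ x → q x + ind a x + ind b x ≡ p x + ind u x) → Move p q

  Reachable : Distribution → V → Set
  Reachable p x = ∃ λ q → Star Move p q × q x ≥ 1

  Squished : Distribution → List V → Set
  Squished p P = ∃ λ a → ∃ λ b → a ∈ P × b ∈ P × (a ≡ b ⊎ Adj a b) ×
                 (∀ x → x ∈ P → p x ≥ 1 → x ≡ a ⊎ x ≡ b)

-- Call a vertex threadable if it has degree 2 and is not v, and consider a segment z 0 … z k whose
-- interior is threadable.  Interior pebbles can only leave through the ends, so two interior pebbles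
-- are never better than one pebble at each end (spread-two), and one interior pebble is never better
-- than one end plus a pebble b next to the other end (spread-one): when a move pushes an interior
-- pebble onto an end, its partner is adjacent to that end and could have made the move with b
-- instead.
--
-- Hence, if v is unreachable from r and two pebbles on a maximal thread are at distance at least 2,
-- moving both one step inward keeps v unreachable and the size fixed, and strictly decreases the
-- moment Σ r(y)·pos(y)² along the thread.  Iterating squishes r on the maximal thread without
-- touching the rest of the graph, and every thread avoiding v lies in a single maximal thread.
module Submission where

open import Defs
open import Data.Nat using (ℕ; zero; suc; _+_; _*_; _∸_; _≤_; _<_; _≥_; z≤n; s≤s; pred; _≤?_; _<?_)
open import Data.Nat.Properties hiding (_≟_)
open import Data.Nat.Properties using () renaming (_≟_ to _≟ℕ_)
open import Data.Nat.Induction using (<-wellFounded; Acc; acc)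
open import Data.Nat.Tactic.RingSolver using (solve-∀)
open import Data.Bool using (true)
import Data.Bool as Bool
open import Data.Fin using (Fin; _≟_; toℕ) renaming (zero to fzero; suc to fsuc)
open import Data.Product using (Σ; ∃; _×_; _,_; proj₁; proj₂)
open import Data.Sum using (_⊎_; inj₁; inj₂; [_,_]′)
import Data.Sum as Sum
import Data.Product as Product
open import Data.Empty using (⊥-elim)
open import Function using (_∘_; id)
open import Relation.Nullary using (¬_; Dec; yes; no)
open import Relation.Nullary.Decidable using (_×-dec_; ¬?; decidable-stable)
import Relation.Nullary.Decidable as Dec
open import Relation.Binary.PropositionalEquality
open import Relation.Binary.Construct.Closure.ReflexiveTransitive using (Star; ε; _◅_)
open import Data.List using (List; []; _∷_; length; filter; allFin; map; tabulate)
open import Data.List.Properties using (map-tabulate; map-cong)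
open import Data.Nat.ListAction using (sum)
open import Data.List.Relation.Unary.Any using (Any; here; there)
import Data.List.Relation.Unary.Any as Any
open import Data.List.Relation.Unary.All using (All; []; _∷_)
import Data.List.Relation.Unary.All as All
open import Data.List.Membership.Propositional using (_∈_; _∉_; lose)
open import Data.List.Membership.Propositional.Properties using (∈-filter⁺; ∈-allFin)
import Data.List.Membership.DecPropositional as DecMembership
import Data.Fin.Properties as Fin
open import Algebra.Properties.CommutativeSemigroup +-commutativeSemigroup using (interchange; xy∙z≈xz∙y)

descent : {A : Set} {Good : A → Set} (μ : A → ℕ) →
          (∀ a → Good a ⊎ Σ A λ b → μ b < μ a) → A → Σ A Good
descent {A} {Good} μ improve a = go a (<-wellFounded (μ a))
  where
    go : ∀ a → Acc _<_ (μ a) → Σ A Good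
    go a (acc rs) with improve a
    ... | inj₁ good = a , good
    ... | inj₂ (b , μb<μa) = go b (rs μb<μa)

search-least : ∀ {P : ℕ → Set} → (∀ t → Dec (P t)) → ∀ n →
               (Σ ℕ λ t → t < n × P t × ∀ s → s < t → ¬ P s) ⊎ (∀ t → t < n → ¬ P t)
search-least P? zero = inj₂ λ _ ()
search-least P? (suc n) with search-least P? n
... | inj₁ (t , t<n , Pt , least) = inj₁ (t , m<n⇒m<1+n t<n , Pt , least)
... | inj₂ none with P? n
...   | yes Pn = inj₁ (n , ≤-refl , Pn , none)
...   | no ¬Pn = inj₂ λ t t<1+n → [ none t , (λ { refl → ¬Pn }) ]′ (m<1+n⇒m<n∨m≡n t<1+n)

≤-offset : ∀ {p t} → p ≤ t → t ≡ p ⊎ t ≡ suc p ⊎ ∃ λ m → t ≡ p + suc (suc m)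
≤-offset {zero} {zero} _ = inj₁ refl
≤-offset {zero} {suc zero} _ = inj₂ (inj₁ refl)
≤-offset {zero} {suc (suc m)} _ = inj₂ (inj₂ (m , refl))
≤-offset {suc p} {suc t} (s≤s p≤t) =
  Sum.map (cong suc) (Sum.map (cong suc) (Product.map₂ (cong suc))) (≤-offset p≤t)

pred<self : ∀ {n} → 0 < n → pred n < n
pred<self {suc n} _ = n<1+n n

≤pred⇒< : ∀ {m n} → 0 < n → m ≤ pred n → m < n
≤pred⇒< {n = suc n} _ m≤n = s≤s m≤n

∸-suc : ∀ {l t} → t < l → l ∸ t ≡ suc (l ∸ suc t)
∸-suc {suc l} {zero} _ = refl
∸-suc {suc l} {suc t} (s≤s t<l) = ∸-suc t<l

+-monoʳ-≤-< : ∀ p {t k n} → t ≤ k → p + k < n → p + t < n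
+-monoʳ-≤-< p t≤k p+k<n = ≤-<-trans (+-monoʳ-≤ p t≤k) p+k<n

∈-pair : ∀ {A : Set} {x a b : A} → x ∈ a ∷ b ∷ [] → x ≡ a ⊎ x ≡ b
∈-pair (here refl) = inj₁ refl
∈-pair (there (here refl)) = inj₂ refl

length≡2⇒∈-distinct : ∀ {A : Set} (xs : List A) {a b y : A} → length xs ≡ 2 →
                      a ∈ xs → b ∈ xs → a ≢ b → y ∈ xs → y ≡ a ⊎ y ≡ b
length≡2⇒∈-distinct (_ ∷ _ ∷ []) _ a∈ b∈ a≢b y∈ with ∈-pair a∈ | ∈-pair b∈ | ∈-pair y∈
... | inj₁ refl | inj₁ refl | _         = ⊥-elim (a≢b refl)
... | inj₂ refl | inj₂ refl | _         = ⊥-elim (a≢b refl)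
... | inj₁ refl | inj₂ refl | inj₁ refl = inj₁ refl
... | inj₁ refl | inj₂ refl | inj₂ refl = inj₂ refl
... | inj₂ refl | inj₁ refl | inj₁ refl = inj₂ refl
... | inj₂ refl | inj₁ refl | inj₂ refl = inj₁ refl

sum-map-+ : ∀ {A : Set} (f g : A → ℕ) xs →
            sum (map (λ x → f x + g x) xs) ≡ sum (map f xs) + sum (map g xs)
sum-map-+ f g [] = refl
sum-map-+ f g (x ∷ xs) = trans (cong (f x + g x +_) (sum-map-+ f g xs))
                               (interchange (f x) (g x) _ _)

sum-tabulate-zero : ∀ {n} (h : Fin n → ℕ) → (∀ y → h y ≡ 0) → sum (tabulate h) ≡ 0
sum-tabulate-zero {zero} h h≡0 = refl
sum-tabulate-zero {suc n} h h≡0 = cong₂ _+_ (h≡0 fzero) (sum-tabulate-zero (h ∘ fsuc) (h≡0 ∘ fsuc))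

sum-tabulate-single : ∀ {n} (h : Fin n → ℕ) c → (∀ y → y ≢ c → h y ≡ 0) → sum (tabulate h) ≡ h c
sum-tabulate-single h fzero h≡0 =
  trans (cong (h fzero +_) (sum-tabulate-zero (h ∘ fsuc) (λ y → h≡0 (fsuc y) λ ())))
        (+-identityʳ (h fzero))
sum-tabulate-single h (fsuc c) h≡0 =
  cong₂ _+_ (h≡0 fzero λ ())
            (sum-tabulate-single (h ∘ fsuc) c (λ y y≢c → h≡0 (fsuc y) (y≢c ∘ Fin.suc-injective)))

2*-as-+ : ∀ i → 2 * i ≡ i + i
2*-as-+ i = cong (i +_) (+-identityʳ i)

+-cancel-middle : ∀ t x i j k → t + (i + j) ≡ x + i + k → t + j ≡ x + k
+-cancel-middle t x i j k eq = +-cancelʳ-≡ i _ _ (trans (shuffle₁ t i j) (trans eq (shuffle₂ x i k)))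
  where
    shuffle₁ : ∀ t i j → t + j + i ≡ t + (i + j)
    shuffle₁ = solve-∀
    shuffle₂ : ∀ x i k → x + i + k ≡ x + k + i
    shuffle₂ = solve-∀

inward-squares : ∀ p m → (p + 1) * (p + 1) + (p + suc m) * (p + suc m) <
                         p * p + (p + suc (suc m)) * (p + suc (suc m))
inward-squares p m = subst ((p + 1) * (p + 1) + (p + suc m) * (p + suc m) <_) (expand p m) (m<m+n _ (s≤s z≤n))
  where
    expand : ∀ p m → (p + 1) * (p + 1) + (p + suc m) * (p + suc m) + (2 + 2 * m) ≡
                     p * p + (p + suc (suc m)) * (p + suc (suc m))
    expand = solve-∀

module Rubbling (G : Graph) where
  open Graph G

  adj⇒≢ : ∀ {a b} → Adj G a b → a ≢ b
  adj⇒≢ {a} a~a refl with trans (sym a~a) (adj-irrefl a)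
  ... | ()

  Adj-sym : ∀ {a b} → Adj G a b → Adj G b a
  Adj-sym {a} {b} a~b = trans (adj-sym b a) a~b

  degree≡2⇒neighbours : ∀ {x a b y} → degree G x ≡ 2 → Adj G x a → Adj G x b → a ≢ b →
                        Adj G x y → y ≡ a ⊎ y ≡ b
  degree≡2⇒neighbours {x} deg x~a x~b a≢b x~y =
    length≡2⇒∈-distinct _ deg (neighbour x~a) (neighbour x~b) a≢b (neighbour x~y)
    where
      neighbour : ∀ {w} → Adj G x w → w ∈ filter (λ w → adj x w Bool.≟ true) (allFin order)
      neighbour {w} = ∈-filter⁺ (λ w → adj x w Bool.≟ true) (∈-allFin w)

  ind-self : ∀ a → ind G a a ≡ 1
  ind-self a with a ≟ a
  ... | yes _ = refl
  ... | no a≢a = ⊥-elim (a≢a refl)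

  ind-≢ : ∀ {a y} → y ≢ a → ind G a y ≡ 0
  ind-≢ {a} {y} y≢a with y ≟ a
  ... | yes y≡a = ⊥-elim (y≢a y≡a)
  ... | no _ = refl

  ind≢0⇒≡ : ∀ {a y} → ind G a y ≢ 0 → y ≡ a
  ind≢0⇒≡ {a} {y} ind≢0 with y ≟ a
  ... | yes y≡a = y≡a
  ... | no _ = ⊥-elim (ind≢0 refl)

  infixl 6 _⊕_ _⊖_
  infix 4 _≤ᵈ_

  _⊕_ : Distribution G → V G → Distribution G
  (p ⊕ a) y = p y + ind G a y

  _⊖_ : Distribution G → V G → Distribution G
  (p ⊖ a) y = p y ∸ ind G a y

  _≤ᵈ_ : Distribution G → Distribution G → Set
  p ≤ᵈ q = ∀ y → p y ≤ q y

  ≤ᵈ-trans : ∀ {p q r} → p ≤ᵈ q → q ≤ᵈ r → p ≤ᵈ r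
  ≤ᵈ-trans p≤q q≤r y = ≤-trans (p≤q y) (q≤r y)

  ≗⇒≤ᵈ : ∀ {p q} → p ≗ q → p ≤ᵈ q
  ≗⇒≤ᵈ p≗q y = ≤-reflexive (p≗q y)

  ≤ᵈ-⊕ : ∀ p a → p ≤ᵈ p ⊕ a
  ≤ᵈ-⊕ p a y = m≤m+n (p y) (ind G a y)

  ≤ᵈ-⊕⊕ : ∀ p a b → p ≤ᵈ p ⊕ a ⊕ b
  ≤ᵈ-⊕⊕ p a b = ≤ᵈ-trans (≤ᵈ-⊕ p a) (≤ᵈ-⊕ (p ⊕ a) b)

  ⊕-monoˡ-≤ᵈ : ∀ {p q} a → p ≤ᵈ q → p ⊕ a ≤ᵈ q ⊕ a
  ⊕-monoˡ-≤ᵈ a p≤q y = +-monoˡ-≤ (ind G a y) (p≤q y)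

  ⊖-≤ᵈ : ∀ p a → p ⊖ a ≤ᵈ p
  ⊖-≤ᵈ p a y = m∸n≤m (p y) (ind G a y)

  ⊕-cong : ∀ {p q} a → p ≗ q → p ⊕ a ≗ q ⊕ a
  ⊕-cong a p≗q y = cong (_+ ind G a y) (p≗q y)

  ⊕-comm : ∀ p a b → p ⊕ a ⊕ b ≗ p ⊕ b ⊕ a
  ⊕-comm p a b y = xy∙z≈xz∙y (p y) (ind G a y) (ind G b y)

  ind-≤ : ∀ (p : Distribution G) a → p a ≥ 1 → ∀ y → ind G a y ≤ p y
  ind-≤ p a pa≥1 y with y ≟ a
  ... | yes refl = pa≥1
  ... | no _ = z≤n

  ⊖-⊕ : ∀ p a → p a ≥ 1 → p ⊖ a ⊕ a ≗ p
  ⊖-⊕ p a pa≥1 y = m∸n+n≡m (ind-≤ p a pa≥1 y)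

  ⊖-⊕-restore : ∀ p d a b → p d ≥ 1 → p ⊖ d ⊕ a ⊕ b ⊕ d ≗ p ⊕ a ⊕ b
  ⊖-⊕-restore p d a b pd≥1 y = begin
    p y ∸ ind G d y + ind G a y + ind G b y + ind G d y
      ≡⟨ shuffle (p y ∸ ind G d y) _ _ _ ⟩
    p y ∸ ind G d y + ind G d y + ind G a y + ind G b y
      ≡⟨ cong (λ w → w + ind G a y + ind G b y) (⊖-⊕ p d pd≥1 y) ⟩
    p y + ind G a y + ind G b y ∎
    where
      open ≡-Reasoning
      shuffle : ∀ w i j l → w + i + j + l ≡ w + l + i + j
      shuffle = solve-∀

  ⊕-⊖ : ∀ p a → p ⊕ a ⊖ a ≗ p
  ⊕-⊖ p a y = m+n∸n≡m (p y) (ind G a y)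

  ⊕-⊖-comm : ∀ p a b → b ≢ a → p ⊕ a ⊖ b ≗ p ⊖ b ⊕ a
  ⊕-⊖-comm p a b b≢a y with y ≟ b
  ... | yes refl rewrite ind-≢ {a} {y} b≢a =
    trans (cong (_∸ 1) (+-identityʳ (p y))) (sym (+-identityʳ (p y ∸ 1)))
  ... | no _ = refl

  ⊕-occupied : ∀ p {a y} → y ≢ a → (p ⊕ a) y ≥ 1 → p y ≥ 1
  ⊕-occupied p {a} {y} y≢a = subst (_≥ 1) (trans (cong (p y +_) (ind-≢ y≢a)) (+-identityʳ (p y)))

  split-pair : ∀ r {a b} → a ≢ b → r a ≥ 1 → r b ≥ 1 → r ⊖ b ⊖ a ⊕ a ⊕ b ≗ r
  split-pair r {a} {b} a≢b ra≥1 rb≥1 y =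
    trans (cong (_+ ind G b y) (⊖-⊕ (r ⊖ b) a r⊖b-occupied y)) (⊖-⊕ r b rb≥1 y)
    where
      r⊖b-occupied : (r ⊖ b) a ≥ 1
      r⊖b-occupied = subst (λ i → r a ∸ i ≥ 1) (sym (ind-≢ a≢b)) ra≥1

  weighted : (V G → ℕ) → Distribution G → ℕ
  weighted w p = sum (map (λ y → p y * w y) (allFin order))

  weighted-⊕ : ∀ w p a → weighted w (p ⊕ a) ≡ weighted w p + w a
  weighted-⊕ w p a = begin
    weighted w (p ⊕ a)
      ≡⟨ cong sum (map-cong (λ y → *-distribʳ-+ (w y) (p y) (ind G a y)) (allFin order)) ⟩
    sum (map (λ y → p y * w y + ind G a y * w y) (allFin order))
      ≡⟨ sum-map-+ (λ y → p y * w y) (λ y → ind G a y * w y) (allFin order) ⟩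
    weighted w p + sum (map (λ y → ind G a y * w y) (allFin order))
      ≡⟨ cong (λ s → weighted w p + sum s) (map-tabulate (λ y → y) (λ y → ind G a y * w y)) ⟩
    weighted w p + sum (tabulate (λ y → ind G a y * w y))
      ≡⟨ cong (weighted w p +_) (sum-tabulate-single _ a (λ y y≢a → cong (_* w y) (ind-≢ y≢a))) ⟩
    weighted w p + ind G a a * w a
      ≡⟨ cong (λ i → weighted w p + i * w a) (ind-self a) ⟩
    weighted w p + (w a + 0)
      ≡⟨ cong (weighted w p +_) (+-identityʳ (w a)) ⟩
    weighted w p + w a ∎
    where open ≡-Reasoning

  weighted-cong : ∀ w {p q} → p ≗ q → weighted w p ≡ weighted w q
  weighted-cong w p≗q = cong sum (map-cong (λ y → cong (_* w y) (p≗q y)) (allFin order))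

  size≡weighted-1 : ∀ p → size G p ≡ weighted (λ _ → 1) p
  size≡weighted-1 p = cong sum (map-cong (λ y → sym (*-identityʳ (p y))) (allFin order))

  size-⊕ : ∀ p a → size G (p ⊕ a) ≡ size G p + 1
  size-⊕ p a = trans (size≡weighted-1 (p ⊕ a))
                     (trans (weighted-⊕ _ p a) (cong (_+ 1) (sym (size≡weighted-1 p))))

  size-cong : ∀ {p q} → p ≗ q → size G p ≡ size G q
  size-cong p≗q = cong sum (map-cong p≗q (allFin order))

  size-⊕⊕ : ∀ p a b → size G (p ⊕ a ⊕ b) ≡ size G p + 1 + 1
  size-⊕⊕ p a b = trans (size-⊕ (p ⊕ a) b) (cong (_+ 1) (size-⊕ p a))

  data Step : Set where
    pebbling : (a u : V G) → Step
    strict   : (a b u : V G) → Step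

  target : Step → V G
  target (pebbling a u) = u
  target (strict a b u) = u

  cost : Step → V G → ℕ
  cost (pebbling a u) y = ind G a y + ind G a y
  cost (strict a b u) y = ind G a y + ind G b y

  Legal : Step → Set
  Legal (pebbling a u) = Adj G a u
  Legal (strict a b u) = a ≢ b × Adj G a u × Adj G b u

  -- Both sides carry what is removed and added, so no truncated subtraction occurs.
  infix 4 _⟶[_]_
  record _⟶[_]_ (p : Distribution G) (σ : Step) (q : Distribution G) : Set where
    constructor balanced
    field balance : ∀ y → q y + cost σ y ≡ p y + ind G (target σ) y
  open _⟶[_]_ public

  move⇒step : ∀ {p q} → Move G p q → Σ Step λ σ → Legal σ × p ⟶[ σ ] q
  move⇒step {p} {q} (pebbling a u a~u eq) =
    pebbling a u , a~u , balanced λ y → trans (cong (q y +_) (sym (2*-as-+ (ind G a y)))) (eq y)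
  move⇒step {p} {q} (strict a b u a≢b a~u b~u eq) =
    strict a b u , (a≢b , a~u , b~u) ,
    balanced λ y → trans (sym (+-assoc (q y) (ind G a y) (ind G b y))) (eq y)

  step⇒move : ∀ {p q} σ → Legal σ → p ⟶[ σ ] q → Move G p q
  step⇒move {p} {q} (pebbling a u) a~u eq =
    pebbling a u a~u λ y → trans (cong (q y +_) (2*-as-+ (ind G a y))) (balance eq y)
  step⇒move {p} {q} (strict a b u) (a≢b , a~u , b~u) eq =
    strict a b u a≢b a~u b~u λ y → trans (+-assoc (q y) (ind G a y) (ind G b y)) (balance eq y)

  ⟶-resp-≗ : ∀ {p p' q σ} → p ≗ p' → p ⟶[ σ ] q → p' ⟶[ σ ] q
  ⟶-resp-≗ {σ = σ} p≗p' p⟶q =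
    balanced λ y → trans (balance p⟶q y) (cong (_+ ind G (target σ) y) (p≗p' y))

  ⟶-⊕ : ∀ {p q σ} c → p ⟶[ σ ] q → p ⊕ c ⟶[ σ ] q ⊕ c
  ⟶-⊕ {p} {q} {σ} c p⟶q = balanced λ y → begin
    q y + ind G c y + cost σ y            ≡⟨ xy∙z≈xz∙y (q y) _ _ ⟩
    q y + cost σ y + ind G c y            ≡⟨ cong (_+ ind G c y) (balance p⟶q y) ⟩
    p y + ind G (target σ) y + ind G c y  ≡⟨ xy∙z≈xz∙y (p y) _ _ ⟩
    p y + ind G c y + ind G (target σ) y  ∎
    where open ≡-Reasoning

  pebbling-step : ∀ p a u → p ⊕ a ⊕ a ⟶[ pebbling a u ] p ⊕ u
  pebbling-step p a u = balanced λ y → rearrange (p y) (ind G u y) (ind G a y)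
    where rearrange : ∀ x k i → x + k + (i + i) ≡ x + i + i + k
          rearrange = solve-∀

  strict-step : ∀ p a b u → p ⊕ a ⊕ b ⟶[ strict a b u ] p ⊕ u
  strict-step p a b u = balanced λ y → rearrange (p y) (ind G u y) (ind G a y) (ind G b y)
    where rearrange : ∀ x k i j → x + k + (i + j) ≡ x + i + j + k
          rearrange = solve-∀

  bystander : ∀ {x t σ} c → x ⊕ c ⟶[ σ ] t → cost σ c ≡ 0 →
              Σ (Distribution G) λ x' → x ⟶[ σ ] x' × t ≗ x' ⊕ c
  bystander {x} {t} {σ} c x⊕c⟶t cost≡0 = t ⊖ c , x⟶t⊖c , λ y → sym (⊖-⊕ t c tc≥1 y)
    where
      tc≥1 : t c ≥ 1
      tc≥1 = begin
        1                                   ≡⟨ sym (ind-self c) ⟩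
        ind G c c                           ≤⟨ m≤n+m (ind G c c) (x c) ⟩
        x c + ind G c c                     ≤⟨ m≤m+n _ (ind G (target σ) c) ⟩
        x c + ind G c c + ind G (target σ) c ≡⟨ sym (balance x⊕c⟶t c) ⟩
        t c + cost σ c                      ≡⟨ cong (t c +_) cost≡0 ⟩
        t c + 0                             ≡⟨ +-identityʳ (t c) ⟩
        t c                                 ∎
        where open ≤-Reasoning
      x⟶t⊖c : x ⟶[ σ ] t ⊖ c
      x⟶t⊖c = balanced λ y → +-cancelʳ-≡ (ind G c y) _ _ (begin
        t y ∸ ind G c y + cost σ y + ind G c y  ≡⟨ xy∙z≈xz∙y (t y ∸ ind G c y) _ _ ⟩
        t y ∸ ind G c y + ind G c y + cost σ y  ≡⟨ cong (_+ cost σ y) (⊖-⊕ t c tc≥1 y) ⟩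
        t y + cost σ y                          ≡⟨ balance x⊕c⟶t y ⟩
        x y + ind G c y + ind G (target σ) y    ≡⟨ xy∙z≈xz∙y (x y) _ _ ⟩
        x y + ind G (target σ) y + ind G c y    ∎)
        where open ≡-Reasoning

  relocation : ∀ {x t d u} → u ≢ d → (∀ y → t y + ind G d y ≡ x y + ind G u y) →
               x d ≥ 1 × t ≗ x ⊖ d ⊕ u
  relocation {x} {t} {d} {u} u≢d eq = xd≥1 , t≗
    where
      xd≥1 : x d ≥ 1
      xd≥1 = subst (_≥ 1) (begin
        t d + ind G d d  ≡⟨ eq d ⟩
        x d + ind G u d  ≡⟨ cong (x d +_) (ind-≢ (u≢d ∘ sym)) ⟩
        x d + 0          ≡⟨ +-identityʳ (x d) ⟩
        x d              ∎) (subst (λ i → t d + i ≥ 1) (sym (ind-self d)) (m≤n+m 1 (t d)))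
        where open ≡-Reasoning
      t≗ : t ≗ x ⊖ d ⊕ u
      t≗ y = begin
        t y                                ≡⟨ sym (m+n∸n≡m (t y) (ind G d y)) ⟩
        t y + ind G d y ∸ ind G d y        ≡⟨ cong (_∸ ind G d y) (eq y) ⟩
        x y + ind G u y ∸ ind G d y        ≡⟨ +-∸-comm (ind G u y) (ind-≤ x d xd≥1 y) ⟩
        x y ∸ ind G d y + ind G u y        ∎
        where open ≡-Reasoning

  -- For a pebbling move the partner is the token's own vertex.
  record Consumption (x t : Distribution G) (c : V G) : Set where
    field
      partner destination : V G
      token~destination   : Adj G c destination
      partner~destination : Adj G partner destination
      partner-occupied    : x partner ≥ 1
      result              : t ≗ x ⊖ partner ⊕ destination

  consumed-with : ∀ {x t c d u} → Adj G c u → Adj G d u →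
                  (∀ y → t y + (ind G c y + ind G d y) ≡ x y + ind G c y + ind G u y) → Consumption x t c
  consumed-with {x} {t} {c} {d} {u} c~u d~u eq = record
    { partner = d ; destination = u ; token~destination = c~u ; partner~destination = d~u
    ; partner-occupied = proj₁ moved ; result = proj₂ moved }
    where
      moved : x d ≥ 1 × t ≗ x ⊖ d ⊕ u
      moved = relocation (adj⇒≢ d~u ∘ sym) λ y → +-cancel-middle (t y) (x y) _ _ _ (eq y)

  consumption : ∀ {x t σ} c → Legal σ → x ⊕ c ⟶[ σ ] t → cost σ c ≢ 0 → Consumption x t c
  consumption {σ = pebbling a u} c a~u x⊕c⟶t cost≢0
    with refl ← ind≢0⇒≡ {a} {c} (cost≢0 ∘ λ ind≡0 → cong₂ _+_ ind≡0 ind≡0) =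
    consumed-with a~u a~u (balance x⊕c⟶t)
  consumption {t = t} {σ = strict a b u} c (a≢b , a~u , b~u) x⊕c⟶t cost≢0 with c ≟ a
  ... | yes refl = consumed-with a~u b~u (balance x⊕c⟶t)
  ... | no c≢a with refl ← ind≢0⇒≡ {b} {c} cost≢0 =
    consumed-with b~u a~u λ y → trans (cong (t y +_) (+-comm (ind G c y) (ind G a y))) (balance x⊕c⟶t y)

  squished-within : ∀ {r P a b} → (∃ λ h → h ∈ P) → a ≡ b ⊎ Adj G a b →
                    (∀ x → x ∈ P → r x ≥ 1 → x ≡ a ⊎ x ≡ b) → Squished G r P
  squished-within {r} {P} {a} {b} (h , h∈P) a≈b occupied with a ∈? P | b ∈? P
    where open DecMembership (_≟_ {n = order}) using (_∈?_)
  ... | yes a∈P | yes b∈P = a , b , a∈P , b∈P , a≈b , occupied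
  ... | yes a∈P | no b∉P = a , a , a∈P , a∈P , inj₁ refl , only-a
    where
      only-a : ∀ x → x ∈ P → r x ≥ 1 → x ≡ a ⊎ x ≡ a
      only-a x x∈P rx≥1 with occupied x x∈P rx≥1
      ... | inj₁ x≡a = inj₁ x≡a
      ... | inj₂ refl = ⊥-elim (b∉P x∈P)
  ... | no a∉P | yes b∈P = b , b , b∈P , b∈P , inj₁ refl , only-b
    where
      only-b : ∀ x → x ∈ P → r x ≥ 1 → x ≡ b ⊎ x ≡ b
      only-b x x∈P rx≥1 with occupied x x∈P rx≥1
      ... | inj₁ refl = ⊥-elim (a∉P x∈P)
      ... | inj₂ x≡b = inj₂ x≡b
  ... | no a∉P | no b∉P = h , h , h∈P , h∈P , inj₁ refl , none
    where
      none : ∀ x → x ∈ P → r x ≥ 1 → x ≡ h ⊎ x ≡ h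
      none x x∈P rx≥1 with occupied x x∈P rx≥1
      ... | inj₁ refl = ⊥-elim (a∉P x∈P)
      ... | inj₂ refl = ⊥-elim (b∉P x∈P)

  squished-cong : ∀ {r r' P} → (∀ y → y ∈ P → r y ≡ r' y) → Squished G r P → Squished G r' P
  squished-cong r≡r' (a , b , a∈P , b∈P , a≈b , occupied) =
    a , b , a∈P , b∈P , a≈b ,
    λ x x∈P r'x≥1 → occupied x x∈P (subst (_≥ 1) (sym (r≡r' x x∈P)) r'x≥1)

module Reachability (G : Graph) (v : V G) where
  open Graph G
  open Rubbling G

  data ReachIn : ℕ → Distribution G → Set where
    done : ∀ {n p} → p v ≥ 1 → ReachIn n p
    step : ∀ {n p q} σ → Legal σ → p ⟶[ σ ] q → ReachIn n q → ReachIn (suc n) p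

  Reach : Distribution G → Set
  Reach p = ∃ λ n → ReachIn n p

  ReachIn-mono : ∀ {n p p'} → p ≤ᵈ p' → ReachIn n p → ReachIn n p'
  ReachIn-mono p≤p' (done pv≥1) = done (≤-trans pv≥1 (p≤p' v))
  ReachIn-mono {p = p} {p'} p≤p' (step {q = q} σ legal p⟶q reach) =
    step σ legal p'⟶q' (ReachIn-mono (λ y → m≤m+n (q y) (p' y ∸ p y)) reach)
    where
      p'⟶q' : p' ⟶[ σ ] (λ y → q y + (p' y ∸ p y))
      p'⟶q' = balanced λ y → begin
        q y + (p' y ∸ p y) + cost σ y            ≡⟨ xy∙z≈xz∙y (q y) _ _ ⟩
        q y + cost σ y + (p' y ∸ p y)            ≡⟨ cong (_+ (p' y ∸ p y)) (balance p⟶q y) ⟩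
        p y + ind G (target σ) y + (p' y ∸ p y)  ≡⟨ xy∙z≈xz∙y (p y) _ _ ⟩
        p y + (p' y ∸ p y) + ind G (target σ) y  ≡⟨ cong (_+ _) (m+[n∸m]≡n (p≤p' y)) ⟩
        p' y + ind G (target σ) y                ∎
        where open ≡-Reasoning

  Reach-mono : ∀ {p p'} → p ≤ᵈ p' → Reach p → Reach p'
  Reach-mono p≤p' (n , reach) = n , ReachIn-mono p≤p' reach

  Reach-resp-≗ : ∀ {p p'} → p ≗ p' → Reach p → Reach p'
  Reach-resp-≗ p≗p' = Reach-mono (≗⇒≤ᵈ p≗p')

  reach-by : ∀ {p q} σ → Legal σ → p ⟶[ σ ] q → Reach q → Reach p
  reach-by σ legal p⟶q (n , reach) = suc n , step σ legal p⟶q reach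

  merge : ∀ {p d b u} → Adj G d u → Adj G b u → Reach (p ⊕ u) → Reach (p ⊕ d ⊕ b)
  merge {p} {d} {b} {u} d~u b~u reach with d ≟ b
  ... | yes refl = reach-by (pebbling d u) d~u (pebbling-step p d u) reach
  ... | no d≢b = reach-by (strict d b u) (d≢b , d~u , b~u) (strict-step p d b u) reach

  Reachable⇒Reach : ∀ {p} → Reachable G p v → Reach p
  Reachable⇒Reach (q , moves , qv≥1) = go moves
    where
      go : ∀ {p} → Star (Move G) p q → Reach p
      go ε = 0 , done qv≥1
      go (move ◅ moves) with σ , legal , p⟶ ← move⇒step move = reach-by σ legal p⟶ (go moves)

  Reach⇒Reachable : ∀ {p} → Reach p → Reachable G p v
  Reach⇒Reachable (_ , reach) = go reach
    where
      go : ∀ {n p} → ReachIn n p → Reachable G p v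
      go {p = p} (done pv≥1) = p , ε , pv≥1
      go (step σ legal p⟶q reach) with q , moves , qv≥1 ← go reach =
        q , step⇒move σ legal p⟶q ◅ moves , qv≥1

module Segments (G : Graph) (v : V G) where
  open Graph G
  open Rubbling G
  open Reachability G v

  Threadable : V G → Set
  Threadable y = degree G y ≡ 2 × y ≢ v

  Inside : ℕ → ℕ → Set
  Inside k s = 0 < s × s < k

  record Segment (k : ℕ) : Set where
    field
      vertex    : ℕ → V G
      adjacent  : ∀ t → t < k → Adj G (vertex t) (vertex (suc t))
      injective : ∀ s t → s ≤ k → t ≤ k → vertex s ≡ vertex t → s ≡ t
      interior  : ∀ s → Inside k s → Threadable (vertex s)

  data Ends (k : ℕ) : ℕ → ℕ → Set where
    left  : Ends k 0 k
    right : Ends k k 0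

  classify : ∀ {k m} → m ≤ k → Inside k m ⊎ m ≡ 0 ⊎ m ≡ k
  classify {k} {zero} _ = inj₂ (inj₁ refl)
  classify {k} {suc m} m≤k with suc m ≟ℕ k
  ... | yes m≡k = inj₂ (inj₂ m≡k)
  ... | no m≢k = inj₁ (s≤s z≤n , ≤∧≢⇒< m≤k m≢k)

  end-of : ∀ {k e o m} → Ends k e o → m ≡ 0 ⊎ m ≡ k → m ≡ e ⊎ m ≡ o
  end-of left = id
  end-of right (inj₁ m≡0) = inj₂ m≡0
  end-of right (inj₂ m≡k) = inj₁ m≡k

  module _ {k : ℕ} (S : Segment k) where
    open Segment S renaming (vertex to z)

    interior-neighbour : ∀ {s y} → Inside k s → Adj G (z s) y → Σ ℕ λ m → m ≤ k × y ≡ z m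
    interior-neighbour {suc t} {y} (_ , t+1<k) zs~y
      with degree≡2⇒neighbours (proj₁ (interior (suc t) (s≤s z≤n , t+1<k)))
             (Adj-sym (adjacent t (<⇒≤ t+1<k))) (adjacent (suc t) t+1<k) z[t]≢z[t+2] zs~y
      where
        z[t]≢z[t+2] : z t ≢ z (suc (suc t))
        z[t]≢z[t+2] eq = m≢1+m+n t {1}
          (trans (injective t (suc (suc t)) (≤-trans (n≤1+n t) (<⇒≤ t+1<k)) t+1<k eq) (cong suc (+-comm 1 t)))
    ... | inj₁ y≡z[t] = t , ≤-trans (n≤1+n t) (<⇒≤ t+1<k) , y≡z[t]
    ... | inj₂ y≡z[t+2] = suc (suc t) , t+1<k , y≡z[t+2]

    interior-occupied : ∀ x {s} → Inside k s → (x ⊕ z s) v ≥ 1 → x v ≥ 1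
    interior-occupied x {s} inside = ⊕-occupied x (proj₂ (interior s inside) ∘ sym)

    spread-one : ∀ n {e o b} x s → Ends k e o → Adj G b (z e) → Inside k s →
                 ReachIn n (x ⊕ z s) → Reach (x ⊕ z o ⊕ b)
    spread-one n {o = o} {b} x s _ _ inside (done v∈) =
      0 , done (≤-trans (interior-occupied x inside v∈) (≤ᵈ-⊕⊕ x (z o) b v))
    spread-one (suc n) {e} {o} {b} x s ends b~e inside (step {q = t} σ legal x⊕zs⟶t reach)
      with cost σ (z s) ≟ℕ 0
    ... | yes cost≡0 with x' , x⟶x' , t≗ ← bystander (z s) x⊕zs⟶t cost≡0 =
      reach-by σ legal (⟶-⊕ b (⟶-⊕ (z o) x⟶x'))
        (spread-one n x' s ends b~e inside (ReachIn-mono (≗⇒≤ᵈ t≗) reach))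
    ... | no cost≢0 = spread-consumed (consumption (z s) legal x⊕zs⟶t cost≢0)
      where
        spread-consumed : Consumption x t (z s) → Reach (x ⊕ z o ⊕ b)
        spread-consumed record { partner = d ; destination = u ; token~destination = zs~u
                               ; partner~destination = d~u ; partner-occupied = xd≥1 ; result = t≗ }
          with interior-neighbour inside zs~u
        ... | m , m≤k , refl with classify m≤k
        ... | inj₁ inside-m = Reach-mono (⊕-monoˡ-≤ᵈ b (⊕-monoˡ-≤ᵈ (z o) (⊖-≤ᵈ x d)))
                                (spread-one n (x ⊖ d) m ends b~e inside-m (ReachIn-mono (≗⇒≤ᵈ t≗) reach))
        ... | inj₂ end with end-of ends end
        ... | inj₁ refl = Reach-resp-≗ (⊖-⊕-restore x d (z o) b xd≥1)
                            (merge b~e d~u (n , ReachIn-mono at-both-ends reach))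
          where
            at-both-ends : t ≤ᵈ x ⊖ d ⊕ z o ⊕ z e
            at-both-ends = ≤ᵈ-trans (≗⇒≤ᵈ t≗)
                             (≤ᵈ-trans (≤ᵈ-⊕ _ (z o)) (≗⇒≤ᵈ (⊕-comm (x ⊖ d) (z e) (z o))))
        ... | inj₂ refl = n , ReachIn-mono at-far-end reach
          where
            at-far-end : t ≤ᵈ x ⊕ z o ⊕ b
            at-far-end = ≤ᵈ-trans (≗⇒≤ᵈ t≗) (≤ᵈ-trans (⊕-monoˡ-≤ᵈ (z o) (⊖-≤ᵈ x d)) (≤ᵈ-⊕ (x ⊕ z o) b))

    spread-two : ∀ n x s s' → Inside k s → Inside k s' →
                 ReachIn n (x ⊕ z s ⊕ z s') → Reach (x ⊕ z 0 ⊕ z k)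
    spread-two-consumed : ∀ n x s s' → Inside k s → Inside k s' → ∀ {t} →
                          Consumption (x ⊕ z s) t (z s') → ReachIn n t → Reach (x ⊕ z 0 ⊕ z k)
    spread-two-relocated : ∀ n x d s m → Inside k s → x d ≥ 1 → Adj G d (z m) →
                           Inside k m ⊎ m ≡ 0 ⊎ m ≡ k → ReachIn n (x ⊖ d ⊕ z s ⊕ z m) →
                           Reach (x ⊕ z 0 ⊕ z k)

    spread-two n x s s' inside inside' (done v∈) =
      0 , done (≤-trans (interior-occupied x inside (interior-occupied (x ⊕ z s) inside' v∈))
                        (≤ᵈ-⊕⊕ x (z 0) (z k) v))
    spread-two (suc n) x s s' inside inside' (step σ legal x⟶t reach)
      with cost σ (z s') ≟ℕ 0 | cost σ (z s) ≟ℕ 0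
    ... | no cost'≢0 | _ =
      spread-two-consumed n x s s' inside inside' (consumption (z s') legal x⟶t cost'≢0) reach
    ... | yes _ | no cost≢0 =
      spread-two-consumed n x s' s inside' inside
        (consumption (z s) legal (⟶-resp-≗ (⊕-comm x (z s) (z s')) x⟶t) cost≢0) reach
    ... | yes cost'≡0 | yes cost≡0
      with x₁ , x⊕zs⟶x₁ , t≗ ← bystander (z s') x⟶t cost'≡0
      with x₂ , x⟶x₂ , x₁≗ ← bystander (z s) x⊕zs⟶x₁ cost≡0 =
      reach-by σ legal (⟶-⊕ (z k) (⟶-⊕ (z 0) x⟶x₂))
        (spread-two n x₂ s s' inside inside'
          (ReachIn-mono (≗⇒≤ᵈ λ y → trans (t≗ y) (⊕-cong (z s') x₁≗ y)) reach))

    spread-two-consumed n x s s' inside inside'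
      record { partner = d ; destination = u ; token~destination = zs'~u
             ; partner~destination = d~u ; partner-occupied = occupied ; result = t≗ } reach
      with interior-neighbour inside' zs'~u
    ... | m , m≤k , refl with z s ≟ d | classify m≤k
    ... | yes refl | inj₁ inside-m =
      spread-two n x m m inside-m inside-m (ReachIn-mono (≤ᵈ-trans merged (≤ᵈ-⊕ _ (z m))) reach)
      where merged = ≗⇒≤ᵈ λ y → trans (t≗ y) (⊕-cong (z m) (⊕-⊖ x (z s)) y)
    ... | yes refl | inj₂ (inj₁ refl) =
      n , ReachIn-mono (≤ᵈ-trans merged (≤ᵈ-⊕ _ (z k))) reach
      where merged = ≗⇒≤ᵈ λ y → trans (t≗ y) (⊕-cong (z 0) (⊕-⊖ x (z s)) y)
    ... | yes refl | inj₂ (inj₂ refl) =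
      n , ReachIn-mono (≤ᵈ-trans merged (⊕-monoˡ-≤ᵈ (z k) (≤ᵈ-⊕ x (z 0)))) reach
      where merged = ≗⇒≤ᵈ λ y → trans (t≗ y) (⊕-cong (z k) (⊕-⊖ x (z s)) y)
    ... | no zs≢d | position =
      spread-two-relocated n x d s m inside (⊕-occupied x (zs≢d ∘ sym) occupied) d~u position
        (ReachIn-mono (≗⇒≤ᵈ λ y → trans (t≗ y) (⊕-cong (z m) (⊕-⊖-comm x (z s) d (zs≢d ∘ sym)) y))
          reach)

    spread-two-relocated n x d s m inside xd≥1 d~zm (inj₁ inside-m) reach =
      Reach-mono (⊕-monoˡ-≤ᵈ (z k) (⊕-monoˡ-≤ᵈ (z 0) (⊖-≤ᵈ x d)))
        (spread-two n (x ⊖ d) s m inside inside-m reach)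
    spread-two-relocated n x d s .0 inside xd≥1 d~z0 (inj₂ (inj₁ refl)) reach =
      Reach-resp-≗ (⊖-⊕-restore x d (z 0) (z k) xd≥1)
        (spread-one n (x ⊖ d ⊕ z 0) s left d~z0 inside
          (ReachIn-mono (≗⇒≤ᵈ (⊕-comm (x ⊖ d) (z s) (z 0))) reach))
    spread-two-relocated n x d s .k inside xd≥1 d~zk (inj₂ (inj₂ refl)) reach =
      Reach-resp-≗ (λ y → trans (⊖-⊕-restore x d (z k) (z 0) xd≥1 y) (⊕-comm x (z k) (z 0) y))
        (spread-one n (x ⊖ d ⊕ z k) s right d~zk inside
          (ReachIn-mono (≗⇒≤ᵈ (⊕-comm (x ⊖ d) (z s) (z k))) reach))

module Chains (G : Graph) (v : V G) where
  open Graph G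
  open Rubbling G
  open Reachability G v
  open Segments G v

  record Chain : Set where
    field
      len        : ℕ
      vertex     : ℕ → V G
      nonempty   : 0 < len
      adjacent   : ∀ t → suc t < len → Adj G (vertex t) (vertex (suc t))
      injective  : ∀ s t → s < len → t < len → vertex s ≡ vertex t → s ≡ t
      threadable : ∀ t → t < len → Threadable (vertex t)

  module _ (T : Chain) where
    open Chain T

    OnChain : V G → Set
    OnChain y = ∃ λ t → t < len × vertex t ≡ y

    onChain? : ∀ y → Dec (OnChain y)
    onChain? y = anyUpTo? (λ t → vertex t ≟ y) len

    ind-off-chain : ∀ {y t} → t < len → ¬ OnChain y → ind G (vertex t) y ≡ 0
    ind-off-chain {t = t} t<len off = ind-≢ λ y≡ → off (t , t<len , sym y≡)

    segment : ∀ p k → p + k < len → Segment k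
    segment p k p+k<len = record
      { vertex    = λ t → vertex (p + t)
      ; adjacent  = λ t t<k → subst (λ w → Adj G (vertex (p + t)) (vertex w)) (sym (+-suc p t))
                                  (adjacent (p + t) (subst (_< len) (+-suc p t) (within (suc t) t<k)))
      ; injective = λ s t s≤k t≤k eq →
                      +-cancelˡ-≡ p s t (injective (p + s) (p + t) (within s s≤k) (within t t≤k) eq)
      ; interior  = λ t (_ , t<k) → threadable (p + t) (within t (<⇒≤ t<k))
      }
      where
        within : ∀ t → t ≤ k → p + t < len
        within t t≤k = +-monoʳ-≤-< p t≤k p+k<len

    -- The value 0 off the chain is junk; the moment only ever compares chain vertices.
    position : V G → ℕ
    position y with onChain? y
    ... | yes (t , _) = t
    ... | no _ = 0

    position-vertex : ∀ t → t < len → position (vertex t) ≡ t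
    position-vertex t t<len with onChain? (vertex t)
    ... | yes (s , s<len , eq) = injective s t s<len t<len eq
    ... | no off = ⊥-elim (off (t , t<len , refl))

    moment : Distribution G → ℕ
    moment = weighted (λ y → position y * position y)

    moment-⊕ : ∀ r t → t < len → moment (r ⊕ vertex t) ≡ moment r + t * t
    moment-⊕ r t t<len =
      trans (weighted-⊕ _ r (vertex t)) (cong (λ i → moment r + i * i) (position-vertex t t<len))

    Gap : Distribution G → ℕ → ℕ → Set
    Gap r p m = p + suc (suc m) < len × r (vertex p) ≥ 1 × r (vertex (p + suc (suc m))) ≥ 1

    ChainSquished : Distribution G → Set
    ChainSquished r = Σ ℕ λ a → Σ ℕ λ b → b < len × (a ≡ b ⊎ suc a ≡ b) ×
                      ∀ t → t < len → r (vertex t) ≥ 1 → t ≡ a ⊎ t ≡ b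

    ⊕⊕-off-chain : ∀ q {s t y} → s < len → t < len → ¬ OnChain y →
                   (q ⊕ vertex s ⊕ vertex t) y ≡ q y
    ⊕⊕-off-chain q {s} {t} {y} s<len t<len off = begin
      q y + ind G (vertex s) y + ind G (vertex t) y
        ≡⟨ cong₂ (λ i j → q y + i + j) (ind-off-chain s<len off) (ind-off-chain t<len off) ⟩
      q y + 0 + 0
        ≡⟨ trans (+-identityʳ (q y + 0)) (+-identityʳ (q y)) ⟩
      q y ∎
      where open ≡-Reasoning

    moment-⊕⊕ : ∀ q s t → s < len → t < len →
                moment (q ⊕ vertex s ⊕ vertex t) ≡ moment q + (s * s + t * t)
    moment-⊕⊕ q s t s<len t<len =
      trans (moment-⊕ (q ⊕ vertex s) t t<len)
            (trans (cong (_+ t * t) (moment-⊕ q s s<len)) (+-assoc (moment q) (s * s) (t * t)))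

    module _ (x : Distribution G) (p m : ℕ) (bound : p + suc (suc m) < len) where
      p<len : p < len
      p<len = ≤-<-trans (m≤m+n p _) bound

      p+1<len : p + 1 < len
      p+1<len = +-monoʳ-≤-< p (s≤s z≤n) bound

      p+m+1<len : p + suc m < len
      p+m+1<len = +-monoʳ-≤-< p (n≤1+n _) bound

      inward-unreachable : ¬ Reach (x ⊕ vertex p ⊕ vertex (p + suc (suc m))) →
                           ¬ Reach (x ⊕ vertex (p + 1) ⊕ vertex (p + suc m))
      inward-unreachable ¬reach (n , reach) =
        ¬reach (Reach-resp-≗ p+0≡p (spread-two (segment p (suc (suc m)) bound) n x 1 (suc m)
                                       (s≤s z≤n , s≤s (s≤s z≤n)) (s≤s z≤n , ≤-refl) reach))
        where
          p+0≡p : x ⊕ vertex (p + 0) ⊕ vertex (p + suc (suc m)) ≗ x ⊕ vertex p ⊕ vertex (p + suc (suc m))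
          p+0≡p y = cong (λ w → (x ⊕ vertex w ⊕ vertex (p + suc (suc m))) y) (+-identityʳ p)

      inward-moment : moment (x ⊕ vertex (p + 1) ⊕ vertex (p + suc m)) <
                      moment (x ⊕ vertex p ⊕ vertex (p + suc (suc m)))
      inward-moment = begin-strict
        moment (x ⊕ vertex (p + 1) ⊕ vertex (p + suc m))
          ≡⟨ moment-⊕⊕ x (p + 1) (p + suc m) p+1<len p+m+1<len ⟩
        moment x + ((p + 1) * (p + 1) + (p + suc m) * (p + suc m))
          <⟨ +-monoʳ-< (moment x) (inward-squares p m) ⟩
        moment x + (p * p + (p + suc (suc m)) * (p + suc (suc m)))
          ≡⟨ sym (moment-⊕⊕ x p (p + suc (suc m)) p<len bound) ⟩
        moment (x ⊕ vertex p ⊕ vertex (p + suc (suc m))) ∎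
        where open ≤-Reasoning

      inward-agrees-off : ∀ y → ¬ OnChain y →
                          (x ⊕ vertex (p + 1) ⊕ vertex (p + suc m)) y ≡
                          (x ⊕ vertex p ⊕ vertex (p + suc (suc m))) y
      inward-agrees-off y off =
        trans (⊕⊕-off-chain x p+1<len p+m+1<len off) (sym (⊕⊕-off-chain x p<len bound off))

    record Rearrangement (r : Distribution G) : Set where
      field
        result      : Distribution G
        unreachable : ¬ Reach result
        same-size   : size G result ≡ size G r
        agrees-off  : ∀ y → ¬ OnChain y → result y ≡ r y
    open Rearrangement

    close-gap : ∀ {r p m} → ¬ Reach r → Gap r p m →
                Σ (Rearrangement r) λ r' → moment (result r') < moment r
    close-gap {r} {p} {m} ¬reach (bound , ra≥1 , rb≥1) = record
      { result      = inward
      ; unreachable = inward-unreachable x p m bound (¬reach ∘ Reach-resp-≗ split)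
      ; same-size   = trans (size-⊕⊕ x _ _) (trans (sym (size-⊕⊕ x a b)) (size-cong split))
      ; agrees-off  = λ y off → trans (inward-agrees-off x p m bound y off) (split y)
      } , subst (moment inward <_) (weighted-cong _ split) (inward-moment x p m bound)
      where
        a b : V G
        a = vertex p
        b = vertex (p + suc (suc m))
        a≢b : a ≢ b
        a≢b eq = m≢1+m+n p (trans (injective p _ (≤-<-trans (m≤m+n p _) bound) bound eq) (+-suc p (suc m)))
        x inward : Distribution G
        x = r ⊖ b ⊖ a
        inward = x ⊕ vertex (p + 1) ⊕ vertex (p + suc m)
        split : x ⊕ a ⊕ b ≗ r
        split = split-pair r a≢b ra≥1 rb≥1

    gap? : ∀ r → Dec (∃ λ p → ∃ λ m → Gap r p m)
    gap? r = Dec.map′ (λ (p , _ , m , _ , gap) → p , m , gap) bounded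
               (anyUpTo? (λ p → anyUpTo? (λ m → gap-at p m) len) len)
      where
        gap-at : ∀ p m → Dec (Gap r p m)
        gap-at p m = (suc (p + suc (suc m)) ≤? len) ×-dec (1 ≤? r (vertex p))
                       ×-dec (1 ≤? r (vertex (p + suc (suc m))))
        bounded : (∃ λ p → ∃ λ m → Gap r p m) → ∃ λ p → p < len × ∃ λ m → m < len × Gap r p m
        bounded (p , m , gap@(p+m+2<len , _)) =
          p , ≤-trans (s≤s (m≤m+n p _)) p+m+2<len ,
          m , ≤-trans (s≤s (≤-trans (n≤1+n m) (≤-trans (n≤1+n _) (m≤n+m _ p)))) p+m+2<len , gap

    no-gap⇒neighbour : ∀ r {p} → ¬ (∃ λ p → ∃ λ m → Gap r p m) → r (vertex p) ≥ 1 →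
                       (∀ s → s < p → ¬ r (vertex s) ≥ 1) →
                       ∀ t → t < len → r (vertex t) ≥ 1 → t ≡ p ⊎ t ≡ suc p
    no-gap⇒neighbour r {p} no-gap rp≥1 first t t<len rt≥1
      with ≤-offset (≮⇒≥ λ t<p → first t t<p rt≥1)
    ... | inj₁ t≡p = inj₁ t≡p
    ... | inj₂ (inj₁ t≡p+1) = inj₂ t≡p+1
    ... | inj₂ (inj₂ (m , refl)) = ⊥-elim (no-gap (p , m , t<len , rp≥1 , rt≥1))

    no-gap⇒squished : ∀ r → ¬ (∃ λ p → ∃ λ m → Gap r p m) → ChainSquished r
    no-gap⇒squished r no-gap with search-least (λ t → 1 ≤? r (vertex t)) len
    ... | inj₂ empty = 0 , 0 , nonempty , inj₁ refl , λ t t<len rt≥1 → ⊥-elim (empty t t<len rt≥1)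
    ... | inj₁ (p , p<len , rp≥1 , first) with suc p <? len
    ...   | yes p+1<len = p , suc p , p+1<len , inj₂ refl , no-gap⇒neighbour r no-gap rp≥1 first
    ...   | no p+1≮len = p , p , p<len , inj₁ refl , λ t t<len rt≥1 →
            Sum.map₂ (λ { refl → ⊥-elim (p+1≮len t<len) })
                     (no-gap⇒neighbour r no-gap rp≥1 first t t<len rt≥1)

    rearrangement-trans : ∀ {r} (r' : Rearrangement r) → Rearrangement (result r') → Rearrangement r
    rearrangement-trans r' r'' = record
      { result      = result r''
      ; unreachable = unreachable r''
      ; same-size   = trans (same-size r'') (same-size r')
      ; agrees-off  = λ y off → trans (agrees-off r'' y off) (agrees-off r' y off)
      }

    squish-along : ∀ r → ¬ Reach r → Σ (Rearrangement r) (ChainSquished ∘ result)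
    squish-along r ¬reach = descent (moment ∘ result) improve
      record { result = r ; unreachable = ¬reach ; same-size = refl ; agrees-off = λ _ _ → refl }
      where
        improve : ∀ r' → ChainSquished (result r') ⊎
                         Σ (Rearrangement r) λ r'' → moment (result r'') < moment (result r')
        improve r' with gap? (result r')
        ... | no no-gap = inj₁ (no-gap⇒squished (result r') no-gap)
        ... | yes (_ , _ , gap) with r'' , decrease ← close-gap (unreachable r') gap =
          inj₂ (rearrangement-trans r' r'' , decrease)

    len≤order : len ≤ order
    len≤order with len ≤? order
    ... | yes len≤order = len≤order
    ... | no len≰order with i , j , i<j , eq ← Fin.pigeonhole (≰⇒> len≰order) (vertex ∘ toℕ) =
      ⊥-elim (<⇒≢ i<j (injective (toℕ i) (toℕ j) (Fin.toℕ<n i) (Fin.toℕ<n j) eq))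

  reverse : Chain → Chain
  reverse T = record
    { len        = len
    ; vertex     = λ t → vertex (pred len ∸ t)
    ; nonempty   = nonempty
    ; adjacent   = λ t t+1<len → let shift = ∸-suc (<⇒≤pred t+1<len) in
                     subst (λ w → Adj G (vertex w) (vertex (pred len ∸ suc t))) (sym shift)
                           (Adj-sym (adjacent (pred len ∸ suc t) (subst (_< len) shift (mirrored t))))
    ; injective  = λ s t s<len t<len eq → ∸-cancelˡ-≡ (<⇒≤pred s<len) (<⇒≤pred t<len)
                                            (injective _ _ (mirrored s) (mirrored t) eq)
    ; threadable = λ t _ → threadable (pred len ∸ t) (mirrored t)
    }
    where
      open Chain T
      mirrored : ∀ t → pred len ∸ t < len
      mirrored t = ≤-<-trans (m∸n≤m (pred len) t) (pred<self nonempty)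

  OnChain-reverse⁺ : ∀ T {y} → OnChain T y → OnChain (reverse T) y
  OnChain-reverse⁺ T (t , t<len , refl) =
    pred len ∸ t , ≤-<-trans (m∸n≤m (pred len) t) (pred<self nonempty) ,
    cong vertex (m∸[m∸n]≡n (<⇒≤pred t<len))
    where open Chain T

  OnChain-reverse⁻ : ∀ T {y} → OnChain (reverse T) y → OnChain T y
  OnChain-reverse⁻ T (t , t<len , eq) =
    pred len ∸ t , ≤-<-trans (m∸n≤m (pred len) t) (pred<self nonempty) , eq
    where open Chain T

  Extends : Chain → V G → Set
  Extends T y = Adj G (Chain.vertex T 0) y × Threadable y × ¬ OnChain T y

  prepend : ∀ T y → Extends T y → Chain
  prepend T y (first~y , threadable-y , y∉T) = record
    { len        = suc len
    ; vertex     = vertex′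
    ; nonempty   = s≤s z≤n
    ; adjacent   = λ { zero _ → Adj-sym first~y ; (suc t) t+2<len → adjacent t (≤-pred t+2<len) }
    ; injective  = injective′
    ; threadable = λ { zero _ → threadable-y ; (suc t) t+1<len → threadable t (≤-pred t+1<len) }
    }
    where
      open Chain T
      vertex′ : ℕ → V G
      vertex′ zero = y
      vertex′ (suc t) = vertex t
      injective′ : ∀ s t → s < suc len → t < suc len → vertex′ s ≡ vertex′ t → s ≡ t
      injective′ zero zero _ _ _ = refl
      injective′ zero (suc t) _ t+1<len eq = ⊥-elim (y∉T (t , ≤-pred t+1<len , sym eq))
      injective′ (suc s) zero s+1<len _ eq = ⊥-elim (y∉T (s , ≤-pred s+1<len , eq))
      injective′ (suc s) (suc t) s+1<len t+1<len eq =
        cong suc (injective s t (≤-pred s+1<len) (≤-pred t+1<len) eq)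

  OnChain-prepend : ∀ T y (ext : Extends T y) {w} → OnChain T w → OnChain (prepend T y ext) w
  OnChain-prepend T y ext (t , t<len , eq) = suc t , s≤s t<len , eq

  Closed : (V G → Set) → Set
  Closed C = ∀ {x y} → C x → Adj G x y → Threadable y → C y

  FrontMaximal : Chain → Set
  FrontMaximal T = ∀ y → Adj G (Chain.vertex T 0) y → Threadable y → OnChain T y

  module _ (T : Chain) where
    open Chain T

    maximal⇒closed : FrontMaximal T → FrontMaximal (reverse T) → Closed (OnChain T)
    maximal⇒closed front back {y = y} (t , t<len , refl) x~y ty with classify (<⇒≤pred t<len)
    ... | inj₁ inside
      with m , m≤ , y≡ ← interior-neighbour (segment T 0 (pred len) (pred<self nonempty)) inside x~y =
        m , ≤pred⇒< nonempty m≤ , sym y≡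
    ... | inj₂ (inj₁ refl) = front y x~y ty
    ... | inj₂ (inj₂ refl) = OnChain-reverse⁻ T (back y x~y ty)

  threadable? : ∀ y → Dec (Threadable y)
  threadable? y = (degree G y ≟ℕ 2) ×-dec ¬? (y ≟ v)

  extension? : ∀ T → Dec (∃ (Extends T))
  extension? T =
    Fin.any? λ y → (adj (Chain.vertex T 0) y Bool.≟ true) ×-dec threadable? y ×-dec ¬? (onChain? T y)

  front-maximal : ∀ T → ¬ ∃ (Extends T) → FrontMaximal T
  front-maximal T no-extension y first~y ty =
    decidable-stable (onChain? T y) λ y∉T → no-extension (y , first~y , ty , y∉T)

  maximal-chain : ∀ x → Threadable x → Σ Chain λ T → OnChain T x × Closed (OnChain T)
  maximal-chain x tx =
    conclude (descent (λ (T , _) → order ∸ Chain.len T) grow (singleton , (0 , s≤s z≤n , refl)))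
    where
      singleton : Chain
      singleton = record
        { len = 1 ; vertex = λ _ → x ; nonempty = s≤s z≤n ; adjacent = λ { _ (s≤s ()) }
        ; injective = λ { zero zero _ _ _ → refl ; (suc _) _ (s≤s ()) _ _ ; zero (suc _) _ (s≤s ()) _ }
        ; threadable = λ _ _ → tx }
      Around-x : Set
      Around-x = Σ Chain λ T → OnChain T x
      longer : ∀ T y ext → order ∸ Chain.len (prepend T y ext) < order ∸ Chain.len T
      longer T y ext = ∸-monoʳ-< (n<1+n (Chain.len T)) (len≤order (prepend T y ext))
      grow : ∀ ((T , _) : Around-x) → FrontMaximal T × FrontMaximal (reverse T) ⊎
             Σ Around-x λ (T' , _) → order ∸ Chain.len T' < order ∸ Chain.len T
      grow (T , x∈T) with extension? T | extension? (reverse T)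
      ... | yes (y , ext) | _ =
        inj₂ ((prepend T y ext , OnChain-prepend T y ext x∈T) , longer T y ext)
      ... | no _ | yes (y , ext) =
        inj₂ ((prepend (reverse T) y ext , OnChain-prepend (reverse T) y ext (OnChain-reverse⁺ T x∈T)) ,
              longer (reverse T) y ext)
      ... | no no-front | no no-back = inj₁ (front-maximal T no-front , front-maximal (reverse T) no-back)
      conclude : Σ Around-x (λ (T , _) → FrontMaximal T × FrontMaximal (reverse T)) →
                 Σ Chain λ T → OnChain T x × Closed (OnChain T)
      conclude ((T , x∈T) , front , back) = T , x∈T , maximal⇒closed T front back

module Squishing (G : Graph) (v : V G) where
  open Graph G
  open Rubbling G
  open Reachability G v
  open Segments G v
  open Chains G v
  open Rearrangement

  AvoidingThread : List (V G) → Set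
  AvoidingThread P = Thread G P × v ∉ P

  threadable-on : ∀ {P} → AvoidingThread P → All Threadable P
  threadable-on {P} ((_ , degree≡2) , v∉P) =
    All.tabulate λ {x} x∈P → degree≡2 x x∈P , λ x≡v → v∉P (subst (_∈ P) x≡v x∈P)

  walk-nonempty : ∀ {P} → IsWalk G P → ∃ λ h → h ∈ P
  walk-nonempty (single x) = x , here refl
  walk-nonempty (cons x _ _ _ _) = x , here refl

  walk-closed : ∀ {C P} → Closed C → IsWalk G P → All Threadable P → Any C P → All C P
  walk-closed closed (single _) _ (here cx) = cx ∷ []
  walk-closed closed (cons _ _ _ x~y walk) (_ ∷ threadable) (here cx) =
    cx ∷ walk-closed closed walk threadable (here (closed cx x~y (All.head threadable)))
  walk-closed closed (cons _ _ _ x~y walk) (tx ∷ threadable) (there meets)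
    with rest-in@(cy ∷ _) ← walk-closed closed walk threadable meets = closed cy (Adj-sym x~y) tx ∷ rest-in

  chain-squished⇒squished : ∀ T r {P} → (∃ λ h → h ∈ P) → All (OnChain T) P →
                            ChainSquished T r → Squished G r P
  chain-squished⇒squished T r {P} P-nonempty on-chain (a , b , b<len , a≈b , occupied) =
    squished-within P-nonempty ends-near (λ x x∈P rx≥1 → at-ends (All.lookup on-chain x∈P) rx≥1)
    where
      open Chain T
      ends-near : vertex a ≡ vertex b ⊎ Adj G (vertex a) (vertex b)
      ends-near = Sum.map (cong vertex) (λ { refl → adjacent a b<len }) a≈b
      at-ends : ∀ {x} → OnChain T x → r x ≥ 1 → x ≡ vertex a ⊎ x ≡ vertex b
      at-ends (t , t<len , refl) rx≥1 = Sum.map (cong vertex) (cong vertex) (occupied t t<len rx≥1)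

  squish-around : ∀ x r → ¬ Reach r → Σ (Distribution G) λ r' → ¬ Reach r' × size G r' ≡ size G r ×
                  ∀ P → AvoidingThread P → x ∈ P ⊎ Squished G r P → Squished G r' P
  squish-around x r ¬reach with threadable? x
  ... | no ¬tx = r , ¬reach , refl , λ P avoiding →
        [ (λ x∈P → ⊥-elim (¬tx (All.lookup (threadable-on avoiding) x∈P))) , id ]′
  ... | yes tx with T , x∈T , closed ← maximal-chain x tx | squish-along T r ¬reach
  ...   | r' , squished = result r' , unreachable r' , same-size r' , settle
    where
      settle : ∀ P → AvoidingThread P → x ∈ P ⊎ Squished G r P → Squished G (result r') P
      settle P avoiding@(((walk , _) , _) , _) earlier with Any.any? (onChain? T) P
      ... | yes meets = chain-squished⇒squished T _ (walk-nonempty walk)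
                          (walk-closed closed walk (threadable-on avoiding) meets) squished
      ... | no misses = squished-cong (λ y y∈P → sym (agrees-off r' y (misses ∘ lose y∈P)))
                          ([ (λ x∈P → ⊥-elim (misses (lose x∈P x∈T))) , id ]′ earlier)

  squish-from : ∀ xs r → ¬ Reach r → Σ (Distribution G) λ r' → ¬ Reach r' × size G r' ≡ size G r ×
                ∀ P → AvoidingThread P → Any (_∈ P) xs → Squished G r' P
  squish-from [] r ¬reach = r , ¬reach , refl , λ _ _ ()
  squish-from (x ∷ xs) r ¬reach
    with r₁ , ¬reach₁ , size₁ , squished₁ ← squish-from xs r ¬reach
    with r₂ , ¬reach₂ , size₂ , squished₂ ← squish-around x r₁ ¬reach₁ =
    r₂ , ¬reach₂ , trans size₂ size₁ , λ where
      P avoiding (here x∈P) → squished₂ P avoiding (inj₁ x∈P)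
      P avoiding (there meets) → squished₂ P avoiding (inj₂ (squished₁ P avoiding meets))

  squish-threads : ∀ r → ¬ Reach r → Σ (Distribution G) λ r' → ¬ Reach r' × size G r' ≡ size G r ×
                   ∀ P → AvoidingThread P → Squished G r' P
  squish-threads r ¬reach with r' , ¬reach' , same , squished ← squish-from (allFin order) r ¬reach =
    r' , ¬reach' , same , λ P avoiding@(((walk , _) , _) , _) →
      let h , h∈P = walk-nonempty walk in squished P avoiding (lose (∈-allFin h) h∈P)

mainTheorem10 : (G : Graph) (v : V G) (n : ℕ) (p : Distribution G) →
    size G p ≡ n → ¬ Reachable G p v →
    Σ (Distribution G) λ r → size G r ≡ n ×
    (∀ (P : List (V G)) → Thread G P → v ∉ P → Squished G r P) ×
    ¬ Reachable G r v
mainTheorem10 G v n p size≡n unreachable =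
  let r , ¬reach , same-size , squished = squish-threads p (unreachable ∘ Reach⇒Reachable)
  in r , trans same-size size≡n , (λ P thread v∉P → squished P (thread , v∉P)) , ¬reach ∘ Reachable⇒Reach
  where
    open Reachability G v
    open Squishing G v
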